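{- Let $\alpha=(\alpha_1,\dots,\alpha_m)$ be a composition with at least one nonzero part, and let $N(\alpha)=\max_{\alpha_i\neq0}\{\alpha_i+i\}$. Then: (1) $0\leqslant c_{i,j}(\alpha)\leqslant c_{i,j+1}(\alpha)\leqslant\alpha_i$ for every $i$ and $j$; (2) $\max\{0,\min\{\alpha_i,\alpha_i+j-N(\alpha)-1\}\}\leqslant c_{i,j}(\alpha)\leqslant\min\{\alpha_i,j-i-1\}$ for every $i$ and every $j\geqslant i+1$; (3) $N(\alpha)+1$ is the smallest index $j$ such that $c_{i,j}(\alpha)=\alpha_i$ for every $i$.
   Context: A (weak) composition is a finite sequence $\alpha=(\alpha_1,\dots,\alpha_m)$ of nonnegative integers, with the convention $\alpha_k=0$ for $k>m$. For a composition $\alpha$, a positive integer $i$ and $j\in\mathbb{N}$, $c_{i,j}(\alpha)$ is defined recursively in $j$: $c_{i,j}(\alpha)=0$ if $j\leqslant i+1$; for $j>i+1$, $c_{i,j}(\alpha)=c_{i,j-1}(\alpha)+1$ if $\alpha_{j-1}<\alpha_i-c_{i,j-1}(\alpha)$, and $c_{i,j}(\alpha)=c_{i,j-1}(\alpha)$ if $\alpha_{j-1}\geqslant\alpha_i-c_{i,j-1}(\alpha)$. -}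

module Defs where

open import Data.Nat using (ℕ; zero; suc; _+_; _∸_; _⊔_; _<ᵇ_; _≡ᵇ_)
open import Data.Bool using (if_then_else_)
open import Data.List using (List; []; _∷_)

Composition : Set
Composition = List ℕ

-- part α k = α_k (1-based), with α_k = 0 for k > m; index 0 is unused (also 0).
part : Composition → ℕ → ℕ
part []       _             = 0
part (x ∷ xs) zero          = 0
part (x ∷ xs) (suc zero)    = x
part (x ∷ xs) (suc (suc k)) = part xs (suc k)

-- c α i j = c_{i,j}(α), by recursion on j:
--   c_{i,j} = 0 if j ≤ i+1;
--   for j > i+1: c_{i,j} = c_{i,j-1} + 1 if α_{j-1} < α_i - c_{i,j-1}, else c_{i,j-1}.
-- (Truncated subtraction is harmless: if c > α_i the strict inequality fails either way.)
c : Composition → ℕ → ℕ → ℕ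
c α i zero    = 0
c α i (suc j) =
  if suc j <ᵇ suc (suc i)
  then 0
  else (if part α j <ᵇ (part α i ∸ c α i j)
        then suc (c α i j)
        else c α i j)

Nfrom : ℕ → List ℕ → ℕ
Nfrom k []       = 0
Nfrom k (x ∷ xs) = (if x ≡ᵇ 0 then 0 else x + k) ⊔ Nfrom (suc k) xs

N : Composition → ℕ
N α = Nfrom 1 α

-- The sequence j ↦ c_{i,j} is 0 up to j = i+1 and then grows by at most one per step,
-- which gives (1) and the upper bound in (2).  The deficit α_i − c_{i,j} never exceeds
-- N(α)+1−j: where c stalls the deficit is at most α_{j−1} ≤ N(α) − (j−1), and where c
-- grows both sides drop by one.  This gives the lower bound in (2), hence c_{i,N(α)+1} = α_i.
-- Conversely, at an index i attaining N(α) the equation c_{i,j} = α_i ≤ j−i−1 forces j > N(α).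
module Submission where

open import Defs
open import Data.Nat using (ℕ; zero; suc; pred; _+_; _∸_; _⊓_; _≤_; _<_; _<ᵇ_; z≤n; s≤s; _≤?_; _<?_)
open import Data.Nat.Properties
open import Data.Bool using (true; false; if_then_else_)
open import Data.List using (List; []; _∷_)
open import Data.Sum using (_⊎_; inj₁; inj₂)
open import Data.Product using (_×_; _,_; ∃; ∃-syntax)
open import Relation.Nullary using (yes; no; contradiction)
open import Relation.Binary.PropositionalEquality using (_≡_; _≢_; refl; sym; trans; cong; subst)

m≢0∧m≤o∸n⇒m+n≤o : ∀ {m n o} → m ≢ 0 → m ≤ o ∸ n → m + n ≤ o
m≢0∧m≤o∸n⇒m+n≤o {m} {n} {o} m≢0 m≤o∸n with n ≤? o
... | yes n≤o = m≤o∸n⇒m+n≤o m n≤o m≤o∸n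
... | no n≰o  = contradiction (n≤0⇒n≡0 (subst (m ≤_) (m≤n⇒m∸n≡0 (<⇒≤ (≰⇒> n≰o))) m≤o∸n)) m≢0

m∸n≤o∸p⇒m⊓[m+p∸o]≤n : ∀ {m n o p} → m ∸ n ≤ o ∸ p → m ⊓ (m + p ∸ o) ≤ n
m∸n≤o∸p⇒m⊓[m+p∸o]≤n {m} {n} {o} {p} m∸n≤o∸p with p ≤? o
... | yes p≤o = ≤-trans (m⊓n≤n m _) (m≤n+o⇒m∸n≤o (m + p) o m+p≤o+n)
  where
  open ≤-Reasoning
  m+p≤o+n : m + p ≤ o + n
  m+p≤o+n = begin
    m + p             ≤⟨ +-monoˡ-≤ p (m≤n+m∸n m n) ⟩
    n + (m ∸ n) + p   ≡⟨ +-assoc n (m ∸ n) p ⟩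
    n + (m ∸ n + p)   ≤⟨ +-monoʳ-≤ n (m≤o∸n⇒m+n≤o (m ∸ n) p≤o m∸n≤o∸p) ⟩
    n + o             ≡⟨ +-comm n o ⟩
    o + n             ∎
... | no p≰o = ≤-trans (m⊓n≤m m _)
  (m∸n≡0⇒m≤n (n≤0⇒n≡0 (subst (m ∸ n ≤_) (m≤n⇒m∸n≡0 (<⇒≤ (≰⇒> p≰o))) m∸n≤o∸p)))

part-zero : ∀ α → part α 0 ≡ 0
part-zero []      = refl
part-zero (_ ∷ _) = refl

part+index≤Nfrom : ∀ xs k t → part xs (suc t) ≢ 0 → part xs (suc t) + (k + t) ≤ Nfrom k xs
part+index≤Nfrom []           k t       x≢0 = contradiction refl x≢0
part+index≤Nfrom (zero ∷ xs)  k zero    x≢0 = contradiction refl x≢0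
part+index≤Nfrom (suc x ∷ xs) k zero    _   rewrite +-identityʳ k = m≤m⊔n (suc x + k) (Nfrom (suc k) xs)
part+index≤Nfrom (x ∷ xs)     k (suc t) x≢0 rewrite +-suc k t =
  ≤-trans (part+index≤Nfrom xs (suc k) t x≢0) (m≤n⊔m _ (Nfrom (suc k) xs))

part≤N∸index : ∀ α k → part α k ≤ N α ∸ k
part≤N∸index α k with part α k ≟ 0
part≤N∸index α k       | yes a≡0 = subst (_≤ N α ∸ k) (sym a≡0) z≤n
part≤N∸index α zero    | no a≢0  = contradiction (part-zero α) a≢0
part≤N∸index α (suc t) | no a≢0  = m+n≤o⇒m≤o∸n (part α (suc t)) (part+index≤Nfrom α 1 t a≢0)

Attains : List ℕ → ℕ → ℕ → Set
Attains xs k M = ∃[ t ] (part xs (suc t) ≢ 0 × part xs (suc t) + (k + t) ≡ M)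

Nfrom-attained : ∀ xs k → Nfrom k xs ≡ 0 ⊎ Attains xs k (Nfrom k xs)
Nfrom-attained []       k = inj₁ refl
Nfrom-attained (x ∷ xs) k = go x (Nfrom-attained xs (suc k))
  where
  shift : ∀ {y M} → Attains xs (suc k) M → Attains (y ∷ xs) k M
  shift (t , x≢0 , eq) = suc t , x≢0 , trans (cong (part xs (suc t) +_) (+-suc k t)) eq

  go : ∀ y → Nfrom (suc k) xs ≡ 0 ⊎ Attains xs (suc k) (Nfrom (suc k) xs) →
       Nfrom k (y ∷ xs) ≡ 0 ⊎ Attains (y ∷ xs) k (Nfrom k (y ∷ xs))
  go zero    (inj₁ eq)   = inj₁ eq
  go zero    (inj₂ best) = inj₂ (shift best)
  go (suc y) rest with ≤-total (Nfrom (suc k) xs) (suc y + k)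
  ... | inj₁ rest≤head = inj₂ (zero , (λ ()) ,
          trans (cong (suc y +_) (+-identityʳ k)) (sym (m≥n⇒m⊔n≡m rest≤head)))
  go (suc y) (inj₁ eq)   | inj₂ head≤rest = contradiction (n≤0⇒n≡0 (subst (suc y + k ≤_) eq head≤rest)) λ ()
  go (suc y) (inj₂ best) | inj₂ head≤rest =
    inj₂ (subst (Attains (suc y ∷ xs) k) (sym (m≤n⇒m⊔n≡n head≤rest)) (shift best))

N-attained : ∀ α → ∃[ k ] (1 ≤ k × part α k ≢ 0) → ∃[ k ] (1 ≤ k × part α k ≢ 0 × part α k + k ≡ N α)
N-attained α (k , _ , a≢0) with Nfrom-attained α 1
... | inj₁ N≡0 = contradiction (n≤0⇒n≡0 (≤-trans (subst (λ M → part α k ≤ M ∸ k) N≡0 (part≤N∸index α k))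
                                                    (≤-reflexive (0∸n≡0 k)))) a≢0
... | inj₂ (t , a≢0′ , eq) = suc t , s≤s z≤n , a≢0′ , eq

module _ (α : Composition) (i : ℕ) where

  c-init : ∀ {j} → j ≤ suc i → c α i j ≡ 0
  c-init {zero}  _ = refl
  c-init {suc j} j≤1+i with suc j <ᵇ suc (suc i) | <⇒<ᵇ (s≤s j≤1+i)
  ... | true | _ = refl

  c-unfold : ∀ {j} → suc i ≤ j →
    c α i (suc j) ≡ (if part α j <ᵇ (part α i ∸ c α i j) then suc (c α i j) else c α i j)
  c-unfold {j} 1+i≤j with suc j <ᵇ suc (suc i) | <ᵇ⇒< (suc j) (suc (suc i))
  ... | true  | lt = contradiction (s≤s 1+i≤j) (<⇒≱ (lt _))
  ... | false | _  = refl

  c-grow : ∀ {j} → suc i ≤ j → part α j < part α i ∸ c α i j → c α i (suc j) ≡ suc (c α i j)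
  c-grow {j} 1+i≤j lt rewrite c-unfold 1+i≤j with part α j <ᵇ (part α i ∸ c α i j) | <⇒<ᵇ lt
  ... | true | _ = refl

  c-stall : ∀ {j} → suc i ≤ j → part α i ∸ c α i j ≤ part α j → c α i (suc j) ≡ c α i j
  c-stall {j} 1+i≤j ge rewrite c-unfold 1+i≤j
    with part α j <ᵇ (part α i ∸ c α i j) | <ᵇ⇒< (part α j) (part α i ∸ c α i j)
  ... | true  | lt = contradiction (lt _) (≤⇒≯ ge)
  ... | false | _  = refl

  data Step (j : ℕ) : Set where
    early : j ≤ i → Step j
    grow  : suc i ≤ j → part α j < part α i ∸ c α i j → c α i (suc j) ≡ suc (c α i j) → Step j
    stall : suc i ≤ j → part α i ∸ c α i j ≤ part α j → c α i (suc j) ≡ c α i j → Step j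

  step : ∀ j → Step j
  step j with j ≤? i
  ... | yes j≤i = early j≤i
  ... | no j≰i with part α j <? part α i ∸ c α i j
  ...   | yes lt = grow (≰⇒> j≰i) lt (c-grow (≰⇒> j≰i) lt)
  ...   | no ≮   = stall (≰⇒> j≰i) (≮⇒≥ ≮) (c-stall (≰⇒> j≰i) (≮⇒≥ ≮))

  c-mono : ∀ j → c α i j ≤ c α i (suc j)
  c-mono j with step j
  ... | early j≤i rewrite c-init (m≤n⇒m≤1+n j≤i) = z≤n
  ... | grow _ _ eq  rewrite eq = n≤1+n _
  ... | stall _ _ eq rewrite eq = ≤-refl

  c≤part : ∀ j → c α i j ≤ part α i
  c≤part zero = z≤n
  c≤part (suc j) with step j
  ... | early j≤i rewrite c-init (s≤s j≤i) = z≤n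
  ... | grow _ lt eq rewrite eq = m∸n≢0⇒n<m (m<n⇒n≢0 lt)
  ... | stall _ _ eq rewrite eq = c≤part j

  c≤j∸[1+i] : ∀ j → c α i j ≤ j ∸ suc i
  c≤j∸[1+i] zero = z≤n
  c≤j∸[1+i] (suc j) with step j
  ... | early j≤i rewrite c-init (s≤s j≤i) = z≤n
  ... | grow 1+i≤j _ eq rewrite eq = ≤-trans (s≤s (c≤j∸[1+i] j)) (≤-reflexive (sym (+-∸-assoc 1 1+i≤j)))
  ... | stall _ _ eq    rewrite eq = ≤-trans (c≤j∸[1+i] j) (∸-monoʳ-≤ j (n≤1+n i))

  part∸c≤1+N∸j : ∀ j → suc i ≤ j → part α i ∸ c α i j ≤ suc (N α) ∸ j
  part∸c≤1+N∸j (suc j) 1+i≤1+j with step j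
  ... | early j≤i rewrite c-init (s≤s j≤i) = ≤-trans (part≤N∸index α i) (∸-monoʳ-≤ (N α) j≤i)
  ... | stall _ ge eq rewrite eq = ≤-trans ge (part≤N∸index α j)
  ... | grow 1+i≤j _ eq rewrite eq = begin
    part α i ∸ suc (c α i j)   ≡⟨ pred[m∸n]≡m∸[1+n] (part α i) (c α i j) ⟨
    pred (part α i ∸ c α i j)  ≤⟨ pred-mono-≤ (part∸c≤1+N∸j j 1+i≤j) ⟩
    pred (suc (N α) ∸ j)       ≡⟨ pred[m∸n]≡m∸[1+n] (suc (N α)) j ⟩
    N α ∸ j                    ∎
    where open ≤-Reasoning

  c-lower : ∀ {j} → suc i ≤ j → part α i ⊓ ((part α i + j) ∸ suc (N α)) ≤ c α i j
  c-lower {j} 1+i≤j = m∸n≤o∸p⇒m⊓[m+p∸o]≤n {o = suc (N α)} {p = j} (part∸c≤1+N∸j j 1+i≤j)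

  c-upper : ∀ j → c α i j ≤ part α i ⊓ (j ∸ i ∸ 1)
  c-upper j = ⊓-glb (c≤part j) (subst (c α i j ≤_) j∸[1+i]≡j∸i∸1 (c≤j∸[1+i] j))
    where
    j∸[1+i]≡j∸i∸1 : j ∸ suc i ≡ j ∸ i ∸ 1
    j∸[1+i]≡j∸i∸1 = trans (cong (j ∸_) (+-comm 1 i)) (sym (∸-+-assoc j i 1))

  c-full : c α i (suc (N α)) ≡ part α i
  c-full with i ≤? N α
  ... | yes i≤N = ≤-antisym (c≤part (suc (N α)))
          (m∸n≡0⇒m≤n (n≤0⇒n≡0 (subst (part α i ∸ c α i (suc (N α)) ≤_) (n∸n≡0 (N α)) (part∸c≤1+N∸j (suc (N α)) (s≤s i≤N)))))
  ... | no i≰N = trans (c-init (s≤s N≤i))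
          (sym (n≤0⇒n≡0 (subst (part α i ≤_) (m≤n⇒m∸n≡0 N≤i) (part≤N∸index α i))))
    where
    N≤i : N α ≤ i
    N≤i = <⇒≤ (≰⇒> i≰N)

  c≡part⇒part+i<j : ∀ {j} → part α i ≢ 0 → c α i j ≡ part α i → part α i + i < j
  c≡part⇒part+i<j {j} a≢0 full = subst (_≤ j) (+-suc (part α i) i)
    (m≢0∧m≤o∸n⇒m+n≤o a≢0 (subst (_≤ j ∸ suc i) full (c≤j∸[1+i] j)))

lemma3p1 : (α : Composition) → ∃ (λ k → 1 ≤ k × part α k ≢ 0) →
    ((i j : ℕ) → 1 ≤ i →
      0 ≤ c α i j × c α i j ≤ c α i (suc j) × c α i (suc j) ≤ part α i)
    × ((i j : ℕ) → 1 ≤ i → suc i ≤ j →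
      (part α i ⊓ ((part α i + j) ∸ suc (N α))) ≤ c α i j
      × c α i j ≤ part α i ⊓ (j ∸ i ∸ 1))
    × (((i : ℕ) → 1 ≤ i → c α i (suc (N α)) ≡ part α i)
      × ((j : ℕ) → ((i : ℕ) → 1 ≤ i → c α i j ≡ part α i) → suc (N α) ≤ j))
lemma3p1 α nonzero =
  (λ i j _ → z≤n , c-mono α i j , c≤part α i (suc j)) ,
  (λ i j _ 1+i≤j → c-lower α i 1+i≤j , c-upper α i j) ,
  (λ i _ → c-full α i) ,
  minimal
  where
  minimal : (j : ℕ) → ((i : ℕ) → 1 ≤ i → c α i j ≡ part α i) → N α < j
  minimal j full with N-attained α nonzero
  ... | k , 1≤k , a≢0 , a+k≡N = subst (_< j) a+k≡N (c≡part⇒part+i<j α k a≢0 (full k 1≤k))
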